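{- Let $A \in \mathbb{R}^{m \times n}$, $b \in \mathbb{R}^m$, $N \in \mathbb{R}^{n \times p}$ and $M \in \mathbb{R}^{m \times q}$. Let $x^*$ be the min-length solution of the least squares problem $\min_{x} \|A x - b\|_2$; let $x^*_{\mathrm{right}} = N y^*$, where $y^*$ is the min-length solution of $\min_{y} \|A N y - b\|_2$; and let $x^*_{\mathrm{left}}$ be the min-length solution of $\min_x \|M^{T} A x - M^{T} b\|_2$. Then: (1) if $\operatorname{range}(N) = \operatorname{range}(A^{T})$, then $x^*_{\mathrm{right}} = x^*$; (2) if $\operatorname{range}(M) = \operatorname{range}(A)$, then $x^*_{\mathrm{left}} = x^*$.
   Context: For a least squares problem $\min_z \|Bz - c\|_2$, the min-length solution is the unique minimizer of $\|z\|_2$ over the (convex, nonempty) set of minimizers of $\|Bz-c\|_2$; it equals $B^\dagger c$, where $B^\dagger$ is the Moore–Penrose pseudoinverse. $\operatorname{range}(B)$ denotes the column space of $B$. -}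

module Defs where

open import Level using (0ℓ)
open import Algebra.Bundles using (CommutativeRing)
open import Relation.Binary.Structures using (IsTotalOrder)
open import Relation.Nullary using (¬_)
open import Data.Product using (Σ; ∃; _×_; _,_)
open import Data.Nat using (ℕ)
import Data.Nat as ℕ
open import Data.Fin using (Fin)
import Data.Fin as F

-- An axiomatic model of the real numbers: a complete ordered field.
-- (agda-stdlib has no reals; all models of these axioms are isomorphic,
-- so quantifying over an arbitrary model states the theorem over ℝ.)
record RealField : Set₁ where
  field
    commRing : CommutativeRing 0ℓ 0ℓ
  open CommutativeRing commRing public
  field
    _≤_          : Carrier → Carrier → Set
    isTotalOrder : IsTotalOrder _≈_ _≤_
    +-mono-≤     : ∀ {x y} z → x ≤ y → (x + z) ≤ (y + z)
    *-nonneg     : ∀ {x y} → 0# ≤ x → 0# ≤ y → 0# ≤ (x * y)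
    0≉1          : ¬ (0# ≈ 1#)
    inverse      : ∀ x → ¬ (x ≈ 0#) → Σ Carrier (λ y → (x * y) ≈ 1#)
    complete     : (P : Carrier → Set) → ∃ P →
                   ∃ (λ u → ∀ x → P x → x ≤ u) →
                   ∃ (λ s → (∀ x → P x → x ≤ s) ×
                            (∀ u → (∀ x → P x → x ≤ u) → s ≤ u))

module _ (R : RealField) where
  open RealField R using (Carrier; _≈_; _+_; _*_; _-_; 0#; _≤_)

  Vec : ℕ → Set
  Vec n = Fin n → Carrier

  Mat : ℕ → ℕ → Set
  Mat m n = Fin m → Fin n → Carrier

  Σ[_] : ∀ n → (Fin n → Carrier) → Carrier
  Σ[ ℕ.zero ] f = 0#
  Σ[ ℕ.suc n ] f = f F.zero + Σ[ n ] (λ i → f (F.suc i))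

  _ᵀ : ∀ {m n} → Mat m n → Mat n m
  (A ᵀ) i j = A j i

  _·_ : ∀ {m n} → Mat m n → Vec n → Vec m
  (A · x) i = Σ[ _ ] (λ j → A i j * x j)

  _⊗_ : ∀ {m n p} → Mat m n → Mat n p → Mat m p
  (A ⊗ B) i k = Σ[ _ ] (λ j → A i j * B j k)

  _⊖_ : ∀ {m} → Vec m → Vec m → Vec m
  (u ⊖ v) i = u i - v i

  _≈ᵥ_ : ∀ {n} → Vec n → Vec n → Set
  u ≈ᵥ v = ∀ i → u i ≈ v i

  -- squared Euclidean norm ‖v‖₂² (minimising ‖·‖₂ ⇔ minimising ‖·‖₂²)
  ‖_‖² : ∀ {n} → Vec n → Carrier
  ‖ v ‖² = Σ[ _ ] (λ i → v i * v i)

  IsLSMinimizer : ∀ {m n} → Mat m n → Vec m → Vec n → Set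
  IsLSMinimizer B c z = ∀ z' → ‖ (B · z) ⊖ c ‖² ≤ ‖ (B · z') ⊖ c ‖²

  IsMinLengthSolution : ∀ {m n} → Mat m n → Vec m → Vec n → Set
  IsMinLengthSolution B c z =
    IsLSMinimizer B c z × (∀ z' → IsLSMinimizer B c z' → ‖ z ‖² ≤ ‖ z' ‖²)

  InRange : ∀ {m n} → Mat m n → Vec m → Set
  InRange B v = ∃ (λ z → (B · z) ≈ᵥ v)

  SameRange : ∀ {m n k} → Mat m n → Mat m k → Set
  SameRange B C = ∀ v → (InRange B v → InRange C v) × (InRange C v → InRange B v)

module Submission where

-- Both parts rest on one uniqueness principle: if A (u − v) = 0 and u, v are both orthogonal
-- to ker A, then ‖u − v‖² = ⟨u − v, u⟩ − ⟨u − v, v⟩ = 0. Perturbing a minimiser along a line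
-- shows that a least-squares residual is orthogonal to range(B) and that the min-length solution
-- is orthogonal to ker B. In (1), range(Aᵀ) ⊆ range(N) turns the normal equations of the
-- preconditioned problem into Aᵀ r = 0 for the residual r of N y*, so A (N y* − x*) = 0, while
-- N y* ∈ range(Aᵀ) ⊥ ker A. In (2), range(M) ⊆ range(A) makes x* an exact solution of the
-- projected problem, hence so is x_left, and range(A) ⊆ range(M) lifts Mᵀ A (x_left − x*) = 0
-- to A (x_left − x*) = 0.

open import Data.Nat using (ℕ; zero; suc)
open import Data.Fin using (Fin)
import Data.Fin as Fin
open import Data.Product using (_,_; proj₁; proj₂; ∃)
open import Data.Sum using (inj₁; inj₂)
open import Data.Empty using (⊥-elim)
open import Relation.Nullary using (¬_)
open import Relation.Binary.Structures using (IsTotalOrder)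
import Relation.Binary.PropositionalEquality as ≡
import Defs
open Defs using (RealField)

module OrderedField (R : RealField) where
  open RealField R renaming (_≤_ to infix 4 _≤_)
  open IsTotalOrder isTotalOrder using (antisym; total)
    renaming (trans to ≤-trans; reflexive to ≤-reflexive;
              ≲-respˡ-≈ to ≤-respˡ-≈; ≲-respʳ-≈ to ≤-respʳ-≈)
  open import Algebra.Properties.Ring ring
    using (-‿injective; -‿involutive; -0#≈0#; -‿distribˡ-*; -‿distribʳ-*;
           -‿+-comm; -‿anti-homo-+; xyx⁻¹≈y; //-rightDividesˡ; [y-z]x≈yx-zx)
  open import Algebra.Properties.Semiring.Mult semiring
    using (_×_; ×-assoc-*; ×-comm-*; ×-congʳ)
  open import Relation.Binary.Reasoning.Setoid setoid

  +-monoˡ-≤ : ∀ z {x y} → x ≤ y → z + x ≤ z + y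
  +-monoˡ-≤ z {x} {y} x≤y = ≤-respˡ-≈ (+-comm x z) (≤-respʳ-≈ (+-comm y z) (+-mono-≤ z x≤y))

  +-cancelˡ-≤ : ∀ z {x y} → z + x ≤ z + y → x ≤ y
  +-cancelˡ-≤ z {x} {y} p = ≤-respˡ-≈ (xyx⁻¹≈y z x) (≤-respʳ-≈ (xyx⁻¹≈y z y) (+-mono-≤ (- z) p))

  +-nonneg : ∀ {x y} → 0# ≤ x → 0# ≤ y → 0# ≤ x + y
  +-nonneg {x} 0≤x 0≤y = ≤-trans 0≤x (≤-respˡ-≈ (+-identityʳ x) (+-monoˡ-≤ x 0≤y))

  x≤0⇒0≤-x : ∀ {x} → x ≤ 0# → 0# ≤ - x
  x≤0⇒0≤-x {x} x≤0 = ≤-respˡ-≈ (-‿inverseʳ x) (≤-respʳ-≈ (+-identityˡ (- x)) (+-mono-≤ (- x) x≤0))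

  0≤-x⇒x≤0 : ∀ {x} → 0# ≤ - x → x ≤ 0#
  0≤-x⇒x≤0 {x} 0≤-x = ≤-respˡ-≈ (+-identityʳ x) (≤-respʳ-≈ (-‿inverseʳ x) (+-monoˡ-≤ x 0≤-x))

  *-monoʳ-≤ : ∀ {x y z} → 0# ≤ z → x ≤ y → x * z ≤ y * z
  *-monoʳ-≤ {x} {y} {z} 0≤z x≤y =
    ≤-respˡ-≈ (+-identityˡ (x * z)) (≤-respʳ-≈ (//-rightDividesˡ (x * z) (y * z))
      (+-mono-≤ (x * z) (≤-respʳ-≈ ([y-z]x≈yx-zx z y x) (*-nonneg 0≤y-x 0≤z))))
    where
    0≤y-x : 0# ≤ y - x
    0≤y-x = ≤-respˡ-≈ (-‿inverseʳ x) (+-mono-≤ (- x) x≤y)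

  -x*-x≈x*x : ∀ x → - x * - x ≈ x * x
  -x*-x≈x*x x = begin
    - x * - x      ≈⟨ -‿distribˡ-* x (- x) ⟨
    - (x * - x)    ≈⟨ -‿cong (-‿distribʳ-* x x) ⟨
    - (- (x * x))  ≈⟨ -‿involutive (x * x) ⟩
    x * x          ∎

  square-nonneg : ∀ x → 0# ≤ x * x
  square-nonneg x with total 0# x
  ... | inj₁ 0≤x = *-nonneg 0≤x 0≤x
  ... | inj₂ x≤0 = ≤-respʳ-≈ (-x*-x≈x*x x) (*-nonneg 0≤-x 0≤-x)
    where 0≤-x = x≤0⇒0≤-x x≤0

  1≰0 : ¬ (1# ≤ 0#)
  1≰0 1≤0 = 0≉1 (antisym (≤-respʳ-≈ (*-identityˡ 1#) (square-nonneg 1#)) 1≤0)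

  nonneg-+≈0⇒≈0 : ∀ {x y} → 0# ≤ x → 0# ≤ y → x + y ≈ 0# → x ≈ 0#
  nonneg-+≈0⇒≈0 {x} 0≤x 0≤y x+y≈0 =
    antisym (≤-respʳ-≈ x+y≈0 (≤-respˡ-≈ (+-identityʳ x) (+-monoˡ-≤ x 0≤y))) 0≤x

  ≈0-wlog-nonneg : (P : Carrier → Set) → (∀ {x} → P x → P (- x)) →
                   (∀ {x} → 0# ≤ x → P x → x ≈ 0#) → ∀ x → P x → x ≈ 0#
  ≈0-wlog-nonneg P P-neg P⇒≈0 x Px with total 0# x
  ... | inj₁ 0≤x = P⇒≈0 0≤x Px
  ... | inj₂ x≤0 = -‿injective (trans (P⇒≈0 (x≤0⇒0≤-x x≤0) (P-neg Px)) (sym -0#≈0#))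

  x+x≈0⇒x≈0 : ∀ x → x + x ≈ 0# → x ≈ 0#
  x+x≈0⇒x≈0 = ≈0-wlog-nonneg (λ x → x + x ≈ 0#)
    (λ {x} x+x≈0 → trans (-‿+-comm x x) (trans (-‿cong x+x≈0) -0#≈0#))
    (λ 0≤x → nonneg-+≈0⇒≈0 0≤x 0≤x)

  -- s - c bounds every n × c = (1 + n) × c - c, so the supremum s of the multiples has s ≤ s - c.
  archimedean : ∀ {c} → (∀ n → n × c ≤ 1#) → c ≤ 0#
  archimedean {c} ≤1
    with complete (λ x → ∃ λ n → x ≈ n × c) (0# , 0 , refl)
                  (1# , λ { x (n , x≈nc) → ≤-respˡ-≈ (sym x≈nc) (≤1 n) })
  ... | s , s-upper , s-least =
    0≤-x⇒x≤0 (+-cancelˡ-≤ s (≤-respˡ-≈ (sym (+-identityʳ s)) s≤s-c))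
    where
    s≤s-c : s ≤ s - c
    s≤s-c = s-least (s - c) λ { x (n , x≈nc) →
      ≤-respˡ-≈ (trans (xyx⁻¹≈y c (n × c)) (sym x≈nc)) (+-mono-≤ (- c) (s-upper (suc n × c) (suc n , refl))) }

  ×-zeroʳ : ∀ n → n × 0# ≈ 0#
  ×-zeroʳ zero    = refl
  ×-zeroʳ (suc n) = trans (+-identityˡ (n × 0#)) (×-zeroʳ n)

  ×-nonneg : ∀ {x} → 0# ≤ x → ∀ n → 0# ≤ n × x
  ×-nonneg 0≤x zero    = ≤-reflexive refl
  ×-nonneg 0≤x (suc n) = +-nonneg 0≤x (×-nonneg 0≤x n)

  ×-nilpotent : ∀ {x} → x * x ≈ 0# → ∀ n → (n × x) * (n × x) ≈ 0#
  ×-nilpotent {x} x²≈0 n = begin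
    (n × x) * (n × x)  ≈⟨ ×-assoc-* n x (n × x) ⟩
    n × (x * n × x)    ≈⟨ ×-congʳ n (×-comm-* n x x) ⟩
    n × n × (x * x)    ≈⟨ ×-congʳ n (×-congʳ n x²≈0) ⟩
    n × n × 0#         ≈⟨ ×-congʳ n (×-zeroʳ n) ⟩
    n × 0#             ≈⟨ ×-zeroʳ n ⟩
    0#                 ∎

  nonneg-nilpotent⇒≤1 : ∀ {x} → 0# ≤ x → x * x ≈ 0# → x ≤ 1#
  nonneg-nilpotent⇒≤1 {x} 0≤x x²≈0 with total x 1#
  ... | inj₁ x≤1 = x≤1
  ... | inj₂ 1≤x = ⊥-elim (1≰0 (≤-trans 1≤x x≤0))
    where
    x≤0 : x ≤ 0#
    x≤0 = ≤-respˡ-≈ (*-identityˡ x) (≤-respʳ-≈ x²≈0 (*-monoʳ-≤ 0≤x 1≤x))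

  -- Without decidable equality, x * x ≈ 0 forces x ≈ 0 only via the Archimedean property (n x ≤ 1 for all n).
  square≈0⇒≈0 : ∀ x → x * x ≈ 0# → x ≈ 0#
  square≈0⇒≈0 = ≈0-wlog-nonneg (λ x → x * x ≈ 0#)
    (λ {x} x²≈0 → trans (-x*-x≈x*x x) x²≈0)
    (λ 0≤x x²≈0 → antisym
       (archimedean (λ n → nonneg-nilpotent⇒≤1 (×-nonneg 0≤x n) (×-nilpotent x²≈0 n))) 0≤x)

  -- Evaluate at t = - a / (K + 1): the quadratic becomes - (a / (K + 1))².
  nonneg-quadratic⇒≈0 : ∀ {a K} → 0# ≤ K → (∀ t → 0# ≤ t * a + (t * t) * K) → a ≈ 0#
  nonneg-quadratic⇒≈0 {a} {K} 0≤K nonneg = begin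
    a                ≈⟨ a≈w[K+1] ⟩
    w * (K + 1#)     ≈⟨ *-congʳ w≈0 ⟩
    0# * (K + 1#)    ≈⟨ zeroˡ (K + 1#) ⟩
    0#               ∎
    where
    K+1≉0 : ¬ (K + 1# ≈ 0#)
    K+1≉0 K+1≈0 = 1≰0 (≤-respˡ-≈ (+-identityˡ 1#) (≤-respʳ-≈ K+1≈0 (+-mono-≤ 1# 0≤K)))
    u : Carrier
    u = proj₁ (inverse (K + 1#) K+1≉0)
    w : Carrier
    w = a * u
    a≈w[K+1] : a ≈ w * (K + 1#)
    a≈w[K+1] = begin
      a                  ≈⟨ *-identityʳ a ⟨
      a * 1#             ≈⟨ *-congˡ (proj₂ (inverse (K + 1#) K+1≉0)) ⟨
      a * ((K + 1#) * u) ≈⟨ *-congˡ (*-comm (K + 1#) u) ⟩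
      a * (u * (K + 1#)) ≈⟨ *-assoc a u (K + 1#) ⟨
      w * (K + 1#)       ∎
    value-at-−w : - w * a + (- w * - w) * K ≈ - (w * w)
    value-at-−w = begin
      - w * a + (- w * - w) * K                     ≈⟨ +-cong (sym (-‿distribˡ-* w a)) (*-congʳ (-x*-x≈x*x w)) ⟩
      - (w * a) + (w * w) * K                       ≈⟨ +-congʳ (-‿cong (*-congˡ a≈w[K+1])) ⟩
      - (w * (w * (K + 1#))) + (w * w) * K          ≈⟨ +-congʳ (-‿cong (*-assoc w w (K + 1#))) ⟨
      - ((w * w) * (K + 1#)) + (w * w) * K          ≈⟨ +-congʳ (-‿cong (distribˡ (w * w) K 1#)) ⟩
      - ((w * w) * K + (w * w) * 1#) + (w * w) * K  ≈⟨ +-congʳ (-‿anti-homo-+ _ _) ⟩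
      (- ((w * w) * 1#) + - ((w * w) * K)) + (w * w) * K ≈⟨ //-rightDividesˡ _ _ ⟩
      - ((w * w) * 1#)                              ≈⟨ -‿cong (*-identityʳ (w * w)) ⟩
      - (w * w)                                     ∎
    w≈0 : w ≈ 0#
    w≈0 = square≈0⇒≈0 w
      (antisym (0≤-x⇒x≤0 (≤-respʳ-≈ value-at-−w (nonneg (- w)))) (square-nonneg w))

module LeastSquares (R : RealField) where
  open RealField R renaming (_≤_ to infix 4 _≤_)
  open OrderedField R
  open IsTotalOrder isTotalOrder using (antisym)
    renaming (reflexive to ≤-reflexive; ≲-respˡ-≈ to ≤-respˡ-≈; ≲-respʳ-≈ to ≤-respʳ-≈)
  open import Algebra.Properties.Ring ring 
    using (-1*x≈-x; x[y-z]≈xy-xz; x∙y⁻¹≈ε⇒x≈y; ⁻¹-anti-homo‿-; \\-leftDividesʳ)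
  open import Algebra.Properties.Semiring.Sum semiring
    using (sum; sum-cong-≋; ∑-distrib-+; ∑-comm; *-distribˡ-sum; *-distribʳ-sum; sum-replicate-zero)
  open import Algebra.Properties.CommutativeSemigroup *-commutativeSemigroup
    using (x∙yz≈y∙xz; xy∙z≈y∙xz)
  open import Algebra.Properties.CommutativeSemigroup +-commutativeSemigroup using (xy∙z≈xz∙y)
  open import Algebra.Solver.Ring.NaturalCoefficients.Default commutativeSemiring
    using (solve; _:+_; _:*_; _:=_)
  open import Relation.Binary.Reasoning.Setoid setoid

  private variable
    m n p : ℕ

  infix  4 _≈ᵥ_
  infixl 6 _⊕_ _⊖_
  infixr 7 _∙_ _·_
  infixl 7 _⊗_

  Vec : ℕ → Set
  Vec = Defs.Vec R

  Mat : ℕ → ℕ → Set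
  Mat = Defs.Mat R

  Σ[_] : ∀ n → (Fin n → Carrier) → Carrier
  Σ[_] = Defs.Σ[_] R

  _ᵀ : Mat m n → Mat n m
  _ᵀ = Defs._ᵀ R

  _·_ : Mat m n → Vec n → Vec m
  _·_ = Defs._·_ R

  _⊗_ : Mat m n → Mat n p → Mat m p
  _⊗_ = Defs._⊗_ R

  _⊖_ : Vec n → Vec n → Vec n
  _⊖_ = Defs._⊖_ R

  _≈ᵥ_ : Vec n → Vec n → Set
  _≈ᵥ_ = Defs._≈ᵥ_ R

  ‖_‖² : Vec n → Carrier
  ‖_‖² = Defs.‖_‖² R

  IsLSMinimizer : Mat m n → Vec m → Vec n → Set
  IsLSMinimizer = Defs.IsLSMinimizer R

  IsMinLengthSolution : Mat m n → Vec m → Vec n → Set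
  IsMinLengthSolution = Defs.IsMinLengthSolution R

  InRange : Mat m n → Vec m → Set
  InRange = Defs.InRange R

  SameRange : ∀ {k} → Mat m n → Mat m k → Set
  SameRange = Defs.SameRange R

  0ᵥ : Vec n
  0ᵥ _ = 0#

  _⊕_ : Vec n → Vec n → Vec n
  (u ⊕ v) i = u i + v i

  _∙_ : Carrier → Vec n → Vec n
  (t ∙ v) i = t * v i

  Σ≡sum : ∀ n (f : Fin n → Carrier) → Σ[ n ] f ≡.≡ sum f
  Σ≡sum zero    f = ≡.refl
  Σ≡sum (suc n) f = ≡.cong (f Fin.zero +_) (Σ≡sum n (λ i → f (Fin.suc i)))

  Σ≈sum : ∀ {n} (f : Fin n → Carrier) → Σ[ n ] f ≈ sum f
  Σ≈sum f = reflexive (Σ≡sum _ f)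

  Σ-cong : ∀ {n} {f g : Fin n → Carrier} → (∀ i → f i ≈ g i) → Σ[ n ] f ≈ Σ[ n ] g
  Σ-cong {f = f} {g} f≈g = trans (Σ≈sum f) (trans (sum-cong-≋ f≈g) (sym (Σ≈sum g)))

  Σ-distrib-+ : ∀ {n} (f g : Fin n → Carrier) → Σ[ n ] (λ i → f i + g i) ≈ Σ[ n ] f + Σ[ n ] g
  Σ-distrib-+ f g = trans (Σ≈sum (λ i → f i + g i)) (trans (∑-distrib-+ f g) (sym (+-cong (Σ≈sum f) (Σ≈sum g))))

  *-distribˡ-Σ : ∀ {n} x (f : Fin n → Carrier) → x * Σ[ n ] f ≈ Σ[ n ] (λ i → x * f i)
  *-distribˡ-Σ x f = trans (*-congˡ (Σ≈sum f)) (trans (*-distribˡ-sum x f) (sym (Σ≈sum (λ i → x * f i))))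

  *-distribʳ-Σ : ∀ {n} x (f : Fin n → Carrier) → Σ[ n ] f * x ≈ Σ[ n ] (λ i → f i * x)
  *-distribʳ-Σ x f = trans (*-congʳ (Σ≈sum f)) (trans (*-distribʳ-sum x f) (sym (Σ≈sum (λ i → f i * x))))

  Σ-neg : ∀ {n} (f : Fin n → Carrier) → Σ[ n ] (λ i → - f i) ≈ - Σ[ n ] f
  Σ-neg f = begin
    Σ[ _ ] (λ i → - f i)       ≈⟨ Σ-cong (λ i → -1*x≈-x (f i)) ⟨
    Σ[ _ ] (λ i → - 1# * f i)  ≈⟨ *-distribˡ-Σ (- 1#) f ⟨
    - 1# * Σ[ _ ] f            ≈⟨ -1*x≈-x (Σ[ _ ] f) ⟩
    - Σ[ _ ] f                 ∎

  Σ-zero : ∀ n → Σ[ n ] (λ _ → 0#) ≈ 0#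
  Σ-zero n = trans (Σ≈sum {n} (λ _ → 0#)) (sum-replicate-zero n)

  Σ-comm : ∀ {m n} (f : Fin m → Fin n → Carrier) →
           Σ[ m ] (λ i → Σ[ n ] (f i)) ≈ Σ[ n ] (λ j → Σ[ m ] (λ i → f i j))
  Σ-comm f = begin
    Σ[ _ ] (λ i → Σ[ _ ] (f i))            ≈⟨ Σ-cong (λ i → Σ≈sum (f i)) ⟩
    Σ[ _ ] (λ i → sum (f i))               ≈⟨ Σ≈sum (λ i → sum (f i)) ⟩
    sum (λ i → sum (f i))                  ≈⟨ ∑-comm f ⟩
    sum (λ j → sum (λ i → f i j))          ≈⟨ Σ≈sum (λ j → sum (λ i → f i j)) ⟨
    Σ[ _ ] (λ j → sum (λ i → f i j))       ≈⟨ Σ-cong (λ j → Σ≈sum (λ i → f i j)) ⟨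
    Σ[ _ ] (λ j → Σ[ _ ] (λ i → f i j))    ∎

  Σ-nonneg : ∀ {n} (f : Fin n → Carrier) → (∀ i → 0# ≤ f i) → 0# ≤ Σ[ n ] f
  Σ-nonneg {zero}  f 0≤f = ≤-reflexive refl
  Σ-nonneg {suc n} f 0≤f = +-nonneg (0≤f Fin.zero) (Σ-nonneg (λ i → f (Fin.suc i)) (λ i → 0≤f (Fin.suc i)))

  Σ-nonneg-≈0 : ∀ {n} (f : Fin n → Carrier) → (∀ i → 0# ≤ f i) → Σ[ n ] f ≈ 0# → ∀ i → f i ≈ 0#
  Σ-nonneg-≈0 {suc n} f 0≤f Σf≈0 Fin.zero =
    nonneg-+≈0⇒≈0 (0≤f Fin.zero) (Σ-nonneg _ (λ i → 0≤f (Fin.suc i))) Σf≈0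
  Σ-nonneg-≈0 {suc n} f 0≤f Σf≈0 (Fin.suc i) =
    Σ-nonneg-≈0 (λ i → f (Fin.suc i)) (λ i → 0≤f (Fin.suc i))
      (nonneg-+≈0⇒≈0 (Σ-nonneg _ (λ i → 0≤f (Fin.suc i))) (0≤f Fin.zero) (trans (+-comm _ _) Σf≈0)) i

  ⟨_,_⟩ : Vec n → Vec n → Carrier
  ⟨ u , v ⟩ = Σ[ _ ] (λ i → u i * v i)

  ⟨⟩-cong : ∀ {u u′ v v′ : Vec n} → u ≈ᵥ u′ → v ≈ᵥ v′ → ⟨ u , v ⟩ ≈ ⟨ u′ , v′ ⟩
  ⟨⟩-cong u≈u′ v≈v′ = Σ-cong (λ i → *-cong (u≈u′ i) (v≈v′ i))

  ⟨⟩-comm : ∀ (u v : Vec n) → ⟨ u , v ⟩ ≈ ⟨ v , u ⟩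
  ⟨⟩-comm u v = Σ-cong (λ i → *-comm (u i) (v i))

  ⟨⟩-linear : ∀ (w u : Vec n) t v → ⟨ w , u ⊕ t ∙ v ⟩ ≈ ⟨ w , u ⟩ + t * ⟨ w , v ⟩
  ⟨⟩-linear w u t v = begin
    Σ[ _ ] (λ i → w i * (u i + t * v i))          ≈⟨ Σ-cong (λ i → distribˡ (w i) (u i) (t * v i)) ⟩
    Σ[ _ ] (λ i → w i * u i + w i * (t * v i))    ≈⟨ Σ-distrib-+ (λ i → w i * u i) (λ i → w i * (t * v i)) ⟩
    ⟨ w , u ⟩ + Σ[ _ ] (λ i → w i * (t * v i))    ≈⟨ +-congˡ (Σ-cong (λ i → x∙yz≈y∙xz (w i) t (v i))) ⟩
    ⟨ w , u ⟩ + Σ[ _ ] (λ i → t * (w i * v i))    ≈⟨ +-congˡ (*-distribˡ-Σ t (λ i → w i * v i)) ⟨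
    ⟨ w , u ⟩ + t * ⟨ w , v ⟩                     ∎

  ⟨⟩-distribˡ-⊖ : ∀ (w u v : Vec n) → ⟨ w , u ⊖ v ⟩ ≈ ⟨ w , u ⟩ - ⟨ w , v ⟩
  ⟨⟩-distribˡ-⊖ w u v = begin
    Σ[ _ ] (λ i → w i * (u i - v i))             ≈⟨ Σ-cong (λ i → x[y-z]≈xy-xz (w i) (u i) (v i)) ⟩
    Σ[ _ ] (λ i → w i * u i - w i * v i)         ≈⟨ Σ-distrib-+ (λ i → w i * u i) (λ i → - (w i * v i)) ⟩
    ⟨ w , u ⟩ + Σ[ _ ] (λ i → - (w i * v i))     ≈⟨ +-congˡ (Σ-neg (λ i → w i * v i)) ⟩
    ⟨ w , u ⟩ - ⟨ w , v ⟩                        ∎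

  ⟨⟩-zeroʳ : ∀ (u : Vec n) {v} → v ≈ᵥ 0ᵥ → ⟨ u , v ⟩ ≈ 0#
  ⟨⟩-zeroʳ {n} u v≈0 = trans (Σ-cong (λ i → trans (*-congˡ (v≈0 i)) (zeroʳ (u i)))) (Σ-zero n)

  ‖‖²-nonneg : ∀ (v : Vec n) → 0# ≤ ‖ v ‖²
  ‖‖²-nonneg v = Σ-nonneg _ (λ i → square-nonneg (v i))

  ‖‖²≈0⇒≈0ᵥ : ∀ {v : Vec n} → ‖ v ‖² ≈ 0# → v ≈ᵥ 0ᵥ
  ‖‖²≈0⇒≈0ᵥ {v = v} ‖v‖²≈0 i =
    square≈0⇒≈0 (v i) (Σ-nonneg-≈0 _ (λ j → square-nonneg (v j)) ‖v‖²≈0 i)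

  ‖‖²-cong : ∀ {u v : Vec n} → u ≈ᵥ v → ‖ u ‖² ≈ ‖ v ‖²
  ‖‖²-cong u≈v = ⟨⟩-cong u≈v u≈v

  ‖⊕∙‖² : ∀ (r v : Vec n) t →
          ‖ r ⊕ t ∙ v ‖² ≈ ‖ r ‖² + (t * (⟨ v , r ⟩ + ⟨ v , r ⟩) + (t * t) * ‖ v ‖²)
  ‖⊕∙‖² r v t = begin
    ⟨ x , x ⟩                                    ≈⟨ ⟨⟩-linear x r t v ⟩
    ⟨ x , r ⟩ + t * ⟨ x , v ⟩                    ≈⟨ +-cong (⟨⟩-comm x r) (*-congˡ (⟨⟩-comm x v)) ⟩
    ⟨ r , x ⟩ + t * ⟨ v , x ⟩                    ≈⟨ +-cong (⟨⟩-linear r r t v) (*-congˡ (⟨⟩-linear v r t v)) ⟩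
    (‖ r ‖² + t * ⟨ r , v ⟩) + t * (g + t * K)   ≈⟨ +-congʳ (+-congˡ (*-congˡ (⟨⟩-comm r v))) ⟩
    (‖ r ‖² + t * g) + t * (g + t * K)           ≈⟨ rearrange ‖ r ‖² g K t ⟩
    ‖ r ‖² + (t * (g + g) + (t * t) * K)         ∎
    where
    x : Vec _
    x = r ⊕ t ∙ v
    g K : Carrier
    g = ⟨ v , r ⟩
    K = ‖ v ‖²
    rearrange : ∀ a g K t → (a + t * g) + t * (g + t * K) ≈ a + (t * (g + g) + (t * t) * K)
    rearrange = solve 4 (λ a g K t →
      (a :+ t :* g) :+ t :* (g :+ t :* K) := a :+ (t :* (g :+ g) :+ (t :* t) :* K)) refl

  -- A quadratic in t that is minimal at t = 0 has vanishing linear coefficient.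
  minimal-on-line⇒⊥ : ∀ (r v : Vec n) → (∀ t → ‖ r ‖² ≤ ‖ r ⊕ t ∙ v ‖²) → ⟨ v , r ⟩ ≈ 0#
  minimal-on-line⇒⊥ r v minimal = x+x≈0⇒x≈0 _ (nonneg-quadratic⇒≈0 (‖‖²-nonneg v) (λ t →
    +-cancelˡ-≤ ‖ r ‖² (≤-respˡ-≈ (sym (+-identityʳ _)) (≤-respʳ-≈ (‖⊕∙‖² r v t) (minimal t)))))

  ⊥-difference⇒≈ : ∀ {u v : Vec n} → ⟨ u ⊖ v , u ⟩ ≈ 0# → ⟨ u ⊖ v , v ⟩ ≈ 0# → u ≈ᵥ v
  ⊥-difference⇒≈ {u = u} {v} d⊥u d⊥v i = x∙y⁻¹≈ε⇒x≈y (u i) (v i) (‖‖²≈0⇒≈0ᵥ ‖d‖²≈0 i)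
    where
    ‖d‖²≈0 : ‖ u ⊖ v ‖² ≈ 0#
    ‖d‖²≈0 = begin
      ⟨ u ⊖ v , u ⊖ v ⟩                ≈⟨ ⟨⟩-distribˡ-⊖ (u ⊖ v) u v ⟩
      ⟨ u ⊖ v , u ⟩ - ⟨ u ⊖ v , v ⟩    ≈⟨ +-cong d⊥u (-‿cong d⊥v) ⟩
      0# - 0#                          ≈⟨ -‿inverseʳ 0# ⟩
      0#                               ∎

  ·-linear : ∀ (B : Mat m n) u t v → B · (u ⊕ t ∙ v) ≈ᵥ B · u ⊕ t ∙ (B · v)
  ·-linear B u t v i = ⟨⟩-linear (B i) u t v

  ·-distrib-⊖ : ∀ (B : Mat m n) u v → B · (u ⊖ v) ≈ᵥ B · u ⊖ B · v
  ·-distrib-⊖ B u v i = ⟨⟩-distribˡ-⊖ (B i) u v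

  ⊗-· : ∀ (A : Mat m n) (N : Mat n p) y → (A ⊗ N) · y ≈ᵥ A · N · y
  ⊗-· A N y i = begin
    Σ[ _ ] (λ k → Σ[ _ ] (λ j → A i j * N j k) * y k)
      ≈⟨ Σ-cong (λ k → *-distribʳ-Σ (y k) (λ j → A i j * N j k)) ⟩
    Σ[ _ ] (λ k → Σ[ _ ] (λ j → (A i j * N j k) * y k))
      ≈⟨ Σ-comm (λ k j → (A i j * N j k) * y k) ⟩
    Σ[ _ ] (λ j → Σ[ _ ] (λ k → (A i j * N j k) * y k))
      ≈⟨ Σ-cong (λ j → Σ-cong (λ k → *-assoc (A i j) (N j k) (y k))) ⟩
    Σ[ _ ] (λ j → Σ[ _ ] (λ k → A i j * (N j k * y k)))
      ≈⟨ Σ-cong (λ j → *-distribˡ-Σ (A i j) (λ k → N j k * y k)) ⟨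
    ⟨ A i , N · y ⟩ ∎

  ᵀ-adjoint : ∀ (B : Mat m n) w d → ⟨ B ᵀ · w , d ⟩ ≈ ⟨ w , B · d ⟩
  ᵀ-adjoint B w d = begin
    Σ[ _ ] (λ j → Σ[ _ ] (λ i → B i j * w i) * d j)
      ≈⟨ Σ-cong (λ j → *-distribʳ-Σ (d j) (λ i → B i j * w i)) ⟩
    Σ[ _ ] (λ j → Σ[ _ ] (λ i → (B i j * w i) * d j))
      ≈⟨ Σ-comm (λ j i → (B i j * w i) * d j) ⟩
    Σ[ _ ] (λ i → Σ[ _ ] (λ j → (B i j * w i) * d j))
      ≈⟨ Σ-cong (λ i → Σ-cong (λ j → xy∙z≈y∙xz (B i j) (w i) (d j))) ⟩
    Σ[ _ ] (λ i → Σ[ _ ] (λ j → w i * (B i j * d j)))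
      ≈⟨ Σ-cong (λ i → *-distribˡ-Σ (w i) (λ j → B i j * d j)) ⟨
    ⟨ w , B · d ⟩ ∎

  InRange⊥ : Mat m n → Vec m → Set
  InRange⊥ B r = ∀ w → ⟨ B · w , r ⟩ ≈ 0#

  InRange⊥-⊥-InRange : ∀ {B : Mat m n} {r u} → InRange⊥ B r → InRange B u → ⟨ u , r ⟩ ≈ 0#
  InRange⊥-⊥-InRange r⊥B (z , Bz≈u) = trans (⟨⟩-cong (λ i → sym (Bz≈u i)) (λ _ → refl)) (r⊥B z)

  InRange∩InRange⊥⇒≈0ᵥ : ∀ {B : Mat m n} {v} → InRange B v → InRange⊥ B v → v ≈ᵥ 0ᵥ
  InRange∩InRange⊥⇒≈0ᵥ v∈B v⊥B = ‖‖²≈0⇒≈0ᵥ (InRange⊥-⊥-InRange v⊥B v∈B)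

  InRange⊥-antitone : ∀ {k} {B : Mat m n} {C : Mat m k} {r} →
                      (∀ v → InRange B v → InRange C v) → InRange⊥ C r → InRange⊥ B r
  InRange⊥-antitone {B = B} B⊆C r⊥C w = InRange⊥-⊥-InRange r⊥C (B⊆C (B · w) (w , λ _ → refl))

  InRange⊥-⊖ : ∀ {B : Mat m n} {r s} → InRange⊥ B r → InRange⊥ B s → InRange⊥ B (r ⊖ s)
  InRange⊥-⊖ {B = B} {r} {s} r⊥B s⊥B w = begin
    ⟨ B · w , r ⊖ s ⟩              ≈⟨ ⟨⟩-distribˡ-⊖ (B · w) r s ⟩
    ⟨ B · w , r ⟩ - ⟨ B · w , s ⟩  ≈⟨ +-cong (r⊥B w) (-‿cong (s⊥B w)) ⟩
    0# - 0#                        ≈⟨ -‿inverseʳ 0# ⟩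
    0#                             ∎

  kernel⇒InRange⊥ᵀ : ∀ {B : Mat m n} {d} → B · d ≈ᵥ 0ᵥ → InRange⊥ (B ᵀ) d
  kernel⇒InRange⊥ᵀ {B = B} {d} Bd≈0 w = trans (ᵀ-adjoint B w d) (⟨⟩-zeroʳ w Bd≈0)

  InRange⊥ᵀ⇒kernel : ∀ {B : Mat m n} {d} → InRange⊥ (B ᵀ) d → B · d ≈ᵥ 0ᵥ
  InRange⊥ᵀ⇒kernel {B = B} {d} d⊥Bᵀ = ‖‖²≈0⇒≈0ᵥ (trans (sym (ᵀ-adjoint B (B · d) d)) (d⊥Bᵀ (B · d)))

  [x-z]-[y-z]≈x-y : ∀ x y z → (x - z) - (y - z) ≈ x - y
  [x-z]-[y-z]≈x-y x y z = begin
    (x - z) - (y - z)    ≈⟨ +-congˡ (⁻¹-anti-homo‿- y z) ⟩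
    (x - z) + (z - y)    ≈⟨ +-assoc x (- z) (z - y) ⟩
    x + (- z + (z - y))  ≈⟨ +-congˡ (\\-leftDividesʳ z (- y)) ⟩
    x - y                ∎

  ·-⊖≈residual-⊖ : ∀ (B : Mat m n) c u v → B · (u ⊖ v) ≈ᵥ (B · u ⊖ c) ⊖ (B · v ⊖ c)
  ·-⊖≈residual-⊖ B c u v i = trans (·-distrib-⊖ B u v i) (sym ([x-z]-[y-z]≈x-y ((B · u) i) ((B · v) i) (c i)))

  LSMinimizer⇒InRange⊥-residual : ∀ {B : Mat m n} {c z} → IsLSMinimizer B c z → InRange⊥ B (B · z ⊖ c)
  LSMinimizer⇒InRange⊥-residual {B = B} {c} {z} z-min w =
    minimal-on-line⇒⊥ (B · z ⊖ c) (B · w) (λ t → ≤-respʳ-≈ (‖‖²-cong (moved t)) (z-min (z ⊕ t ∙ w)))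
    where
    moved : ∀ t → B · (z ⊕ t ∙ w) ⊖ c ≈ᵥ (B · z ⊖ c) ⊕ t ∙ (B · w)
    moved t i = trans (+-congʳ (·-linear B z t w i)) (xy∙z≈xz∙y ((B · z) i) (t * (B · w) i) (- c i))

  minLength⇒⊥-kernel : ∀ {B : Mat m n} {c z w} → IsMinLengthSolution B c z → B · w ≈ᵥ 0ᵥ → ⟨ w , z ⟩ ≈ 0#
  minLength⇒⊥-kernel {B = B} {c} {z} {w} (z-min , z-shortest) Bw≈0 =
    minimal-on-line⇒⊥ z w (λ t → z-shortest (z ⊕ t ∙ w) (λ z′ →
      ≤-respˡ-≈ (‖‖²-cong (same-residual t)) (z-min z′)))
    where
    same-residual : ∀ t → B · z ⊖ c ≈ᵥ B · (z ⊕ t ∙ w) ⊖ c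
    same-residual t i = +-congʳ (sym (trans (·-linear B z t w i)
      (trans (+-congˡ (trans (*-congˡ (Bw≈0 i)) (zeroʳ t))) (+-identityʳ _))))

  LSMinimizer-exact : ∀ {B : Mat m n} {c z z₀} → IsLSMinimizer B c z →
                      B · z₀ ⊖ c ≈ᵥ 0ᵥ → B · z ⊖ c ≈ᵥ 0ᵥ
  LSMinimizer-exact {B = B} {c} {z} {z₀} z-min z₀-exact = ‖‖²≈0⇒≈0ᵥ
    (antisym (≤-respʳ-≈ (⟨⟩-zeroʳ (B · z₀ ⊖ c) z₀-exact) (z-min z₀)) (‖‖²-nonneg (B · z ⊖ c)))

  right-preconditioned-solution :
    ∀ {A : Mat m n} {b} {N : Mat n p} {x y} →
    IsMinLengthSolution A b x → IsLSMinimizer (A ⊗ N) b y → SameRange N (A ᵀ) → N · y ≈ᵥ x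
  right-preconditioned-solution {A = A} {b} {N} {x} {y} x-min y-min N~Aᵀ =
    ⊥-difference⇒≈ d⊥Ny (minLength⇒⊥-kernel x-min Ad≈0)
    where
    r : Vec _
    r = A · N · y ⊖ b
    d : Vec _
    d = N · y ⊖ x
    Aᵀr⊥N : InRange⊥ N (A ᵀ · r)
    Aᵀr⊥N w = begin
      ⟨ N · w , A ᵀ · r ⟩                ≈⟨ ⟨⟩-comm (N · w) (A ᵀ · r) ⟩
      ⟨ A ᵀ · r , N · w ⟩                ≈⟨ ᵀ-adjoint A r (N · w) ⟩
      ⟨ r , A · N · w ⟩                  ≈⟨ ⟨⟩-comm r (A · N · w) ⟩
      ⟨ A · N · w , r ⟩
        ≈⟨ ⟨⟩-cong (λ i → sym (⊗-· A N w i)) (λ i → +-congʳ (sym (⊗-· A N y i))) ⟩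
      ⟨ (A ⊗ N) · w , (A ⊗ N) · y ⊖ b ⟩  ≈⟨ LSMinimizer⇒InRange⊥-residual {B = A ⊗ N} y-min w ⟩
      0#                                 ∎
    r⊥A : InRange⊥ A r
    r⊥A = kernel⇒InRange⊥ᵀ {B = A ᵀ}
      (InRange∩InRange⊥⇒≈0ᵥ (proj₂ (N~Aᵀ (A ᵀ · r)) (r , λ _ → refl)) Aᵀr⊥N)
    Ad≈r⊖r* : A · d ≈ᵥ r ⊖ (A · x ⊖ b)
    Ad≈r⊖r* = ·-⊖≈residual-⊖ A b (N · y) x
    r⊖r*⊥A : InRange⊥ A (r ⊖ (A · x ⊖ b))
    r⊖r*⊥A = InRange⊥-⊖ {B = A} r⊥A (LSMinimizer⇒InRange⊥-residual {B = A} (proj₁ x-min))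
    Ad≈0 : A · d ≈ᵥ 0ᵥ
    Ad≈0 i = trans (Ad≈r⊖r* i) (InRange∩InRange⊥⇒≈0ᵥ (d , Ad≈r⊖r*) r⊖r*⊥A i)
    d⊥Ny : ⟨ d , N · y ⟩ ≈ 0#
    d⊥Ny = trans (⟨⟩-comm d (N · y))
      (InRange⊥-⊥-InRange (kernel⇒InRange⊥ᵀ {B = A} Ad≈0) (proj₁ (N~Aᵀ (N · y)) (y , λ _ → refl)))

  left-preconditioned-solution :
    ∀ {q} {A : Mat m n} {b} {M : Mat m q} {x x′} →
    IsMinLengthSolution A b x → IsMinLengthSolution (M ᵀ ⊗ A) (M ᵀ · b) x′ → SameRange M A → x′ ≈ᵥ x
  left-preconditioned-solution {A = A} {b} {M} {x} {x′} x-min x′-min M~A =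
    ⊥-difference⇒≈ (minLength⇒⊥-kernel x′-min MᵀAd≈0) (minLength⇒⊥-kernel x-min Ad≈0)
    where
    d : Vec _
    d = x′ ⊖ x
    r*⊥M : InRange⊥ M (A · x ⊖ b)
    r*⊥M = InRange⊥-antitone (λ v → proj₁ (M~A v)) (LSMinimizer⇒InRange⊥-residual {B = A} (proj₁ x-min))
    x-exact : (M ᵀ ⊗ A) · x ⊖ M ᵀ · b ≈ᵥ 0ᵥ
    x-exact i = begin
      ((M ᵀ ⊗ A) · x) i - (M ᵀ · b) i  ≈⟨ +-congʳ (⊗-· (M ᵀ) A x i) ⟩
      (M ᵀ · A · x) i - (M ᵀ · b) i    ≈⟨ ·-distrib-⊖ (M ᵀ) (A · x) b i ⟨
      (M ᵀ · (A · x ⊖ b)) i            ≈⟨ InRange⊥ᵀ⇒kernel {B = M ᵀ} r*⊥M i ⟩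
      0#                               ∎
    MᵀAd≈0 : (M ᵀ ⊗ A) · d ≈ᵥ 0ᵥ
    MᵀAd≈0 i = trans (·-⊖≈residual-⊖ (M ᵀ ⊗ A) (M ᵀ · b) x′ x i)
      (trans (+-cong (LSMinimizer-exact (proj₁ x′-min) x-exact i) (-‿cong (x-exact i))) (-‿inverseʳ 0#))
    Ad≈0 : A · d ≈ᵥ 0ᵥ
    Ad≈0 = InRange∩InRange⊥⇒≈0ᵥ (proj₂ (M~A (A · d)) (d , λ _ → refl))
      (kernel⇒InRange⊥ᵀ {B = M ᵀ} (λ i → trans (sym (⊗-· (M ᵀ) A d i)) (MᵀAd≈0 i)))

open Defs using (Vec; Mat; IsMinLengthSolution; SameRange; _⊗_; _·_; _ᵀ; _≈ᵥ_)
open import Data.Product using (_×_)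
open LeastSquares using (right-preconditioned-solution; left-preconditioned-solution)

theorem3p2 : (R : RealField) → (m n p q : ℕ) →
    (A : Mat R m n) (b : Vec R m) (N : Mat R n p) (M : Mat R m q) →
    (xstar : Vec R n) → IsMinLengthSolution R A b xstar →
    ((ystar : Vec R p) → IsMinLengthSolution R (_⊗_ R A N) b ystar →
      SameRange R N (_ᵀ R A) → _≈ᵥ_ R (_·_ R N ystar) xstar)
    ×
    ((xleft : Vec R n) →
      IsMinLengthSolution R (_⊗_ R (_ᵀ R M) A) (_·_ R (_ᵀ R M) b) xleft →
      SameRange R M A → _≈ᵥ_ R xleft xstar)
theorem3p2 R m n p q A b N M xstar xstar-min =
  (λ ystar ystar-min N~Aᵀ → right-preconditioned-solution R xstar-min (proj₁ ystar-min) N~Aᵀ) ,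
  (λ xleft xleft-min M~A → left-preconditioned-solution R xstar-min xleft-min M~A)
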